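{- Let $V=V^\flat\oplus Fe$ be an $F$-vector space, with $F_0$-structure and involution as in the context. Let $\gamma'\in S(V_0)(F_0)$, written as $\gamma'(x)=a(x)+c(x)e$ ($x\in V^\flat$), $\gamma'(e)=b+de$, with $d\neq1$, and put $\gamma=a+\frac{bc}{1-d}$, $b_1=\frac{b}{1-d}$, $c_1=\frac{c}{1-d}$ (so $\gamma\in S(V_0^\flat)(F_0)$). Let $B_\gamma\in\mathrm{GL}(V^\flat)(F_0)$ be a twisting element for $\gamma$, and put $b_2=B_\gamma^{ -1}b_1$, $c_2=c_1\overline{B_\gamma}$. Then: (1) $(b_2,c_2)\in V_0^\flat\times(V_0^\flat)^*$, and $c_2\gamma^{i+1}b_2=c_1\gamma^ib_1$ for all $i\in\mathbb Z$; (2) the $\mathrm{GL}(V_0^\flat)(F_0)$-orbit of $(\gamma,b_2,c_2)$ in $(S(V_0^\flat)\times V_0^\flat\times(V_0^\flat)^*)(F_0)$ does not depend on the choice of twisting element $B_\gamma$ and depends only on the $\mathrm{GL}(V_0^\flat)(F_0)$-conjugacy orbit of $\gamma'$.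
   Context: $F/F_0$ is an unramified quadratic extension of $p$-adic local fields. A basis $e_1,\dots,e_{n-1}$ of $V^\flat$ gives $F_0$-structures $V_0^\flat=\oplus F_0e_i$ and $V_0=V_0^\flat\oplus F_0e$, hence an $F/F_0$-semilinear involution $\bar{\ }$ of $V$ with fixed space $V_0$, and induced involutions on $V^*$, $\mathrm{End}(V)$. $S(V_0)=\{\gamma\in\mathrm{GL}(V):\gamma\bar\gamma=1\}$, similarly $S(V_0^\flat)\subseteq\mathrm{GL}(V^\flat)$. $\mathrm{GL}(V_0^\flat)$ acts on $S(V_0)$ by conjugation (fixing $e$) and on $S(V_0^\flat)\times V_0^\flat\times(V_0^\flat)^*$ by $h.(\gamma,b,c)=(h^{ -1}\gamma h,h^{ -1}b,ch)$. A twisting element for $\gamma\in S(V_0^\flat)(F_0)$ is $B_\gamma\in\mathrm{GL}(V^\flat)(F_0)$ with $\gamma=B_\gamma\overline{B_\gamma}^{ -1}=\overline{B_\gamma}^{ -1}B_\gamma$. -}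

module Defs where

open import Level using (Level; _⊔_) renaming (suc to lsuc)
open import Algebra.Bundles using (CommutativeRing)
open import Data.Nat using (ℕ; zero; suc)
open import Data.Fin using (Fin; zero; suc)
open import Data.Integer using (ℤ; +_; -[1+_])
open import Data.Product using (Σ; ∃; _×_; _,_)
open import Relation.Nullary using (¬_)

-- A field F together with a field automorphism σ of order exactly 2.
-- F₀ := {x | σ x ≈ x} is the fixed field, so F/F₀ is a quadratic
-- (Galois) extension with Galois involution σ (the "bar").
record FieldInv (c ℓ : Level) : Set (lsuc (c ⊔ ℓ)) where
  field
    commRing : CommutativeRing c ℓ
  open CommutativeRing commRing public
  field
    0≉1      : ¬ (0# ≈ 1#)
    inverse  : ∀ x → ¬ (x ≈ 0#) → ∃ λ y → x * y ≈ 1#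
    σ        : Carrier → Carrier
    σ-cong   : ∀ {x y} → x ≈ y → σ x ≈ σ y
    σ-+      : ∀ x y → σ (x + y) ≈ σ x + σ y
    σ-*      : ∀ x y → σ (x * y) ≈ σ x * σ y
    σ-1      : σ 1# ≈ 1#
    σ-invol  : ∀ x → σ (σ x) ≈ x
    σ-nontriv : ∃ λ x → ¬ (σ x ≈ x)

-- Linear algebra in coordinates w.r.t. the basis e₁,…,e_m of V♭
-- (and e₁,…,e_m,e of V; the index 'zero' of Fin (suc m) stands for e,
-- 'suc i' for e_{i+1}).
module Ops {c ℓ : Level} (F : FieldInv c ℓ) where
  open FieldInv F using (Carrier; _≈_; _+_; _*_; _-_; 0#; 1#; σ)

  -- column vectors (elements of V♭) and row vectors (elements of (V♭)*)
  Vect : ℕ → Set c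
  Vect n = Fin n → Carrier

  Mat : ℕ → ℕ → Set c
  Mat m n = Fin m → Fin n → Carrier

  ∑ : ∀ {n} → (Fin n → Carrier) → Carrier
  ∑ {zero}  f = 0#
  ∑ {suc n} f = f zero + ∑ (λ i → f (suc i))

  _⊗_ : ∀ {m n k} → Mat m n → Mat n k → Mat m k
  (A ⊗ B) i j = ∑ (λ l → A i l * B l j)

  _▷_ : ∀ {m n} → Mat m n → Vect n → Vect m
  (A ▷ v) i = ∑ (λ l → A i l * v l)

  _◁_ : ∀ {m n} → Vect m → Mat m n → Vect n
  (r ◁ A) j = ∑ (λ l → r l * A l j)

  ⟪_,_⟫ : ∀ {n} → Vect n → Vect n → Carrier
  ⟪ r , v ⟫ = ∑ (λ l → r l * v l)

  I : ∀ {n} → Mat n n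
  I zero    zero    = 1#
  I zero    (suc j) = 0#
  I (suc i) zero    = 0#
  I (suc i) (suc j) = I i j

  O : ∀ {m n} → Mat m n
  O i j = 0#

  _≈M_ : ∀ {m n} → Mat m n → Mat m n → Set ℓ
  A ≈M B = ∀ i j → A i j ≈ B i j

  _≈V_ : ∀ {n} → Vect n → Vect n → Set ℓ
  v ≈V w = ∀ i → v i ≈ w i

  conjM : ∀ {m n} → Mat m n → Mat m n
  conjM A i j = σ (A i j)

  conjV : ∀ {n} → Vect n → Vect n
  conjV v i = σ (v i)

  IsF₀V : ∀ {n} → Vect n → Set ℓ
  IsF₀V v = conjV v ≈V v

  IsF₀M : ∀ {m n} → Mat m n → Set ℓ
  IsF₀M A = conjM A ≈M A

  pow : ∀ {n} → Mat n n → ℕ → Mat n n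
  pow A zero    = I
  pow A (suc k) = A ⊗ pow A k

  zpow : ∀ {n} → Mat n n → Mat n n → ℤ → Mat n n
  zpow A Ai (+ k)     = pow A k
  zpow A Ai -[1+ k ]  = pow Ai (suc k)

  InS : ∀ {n} → Mat n n → Set ℓ
  InS A = (A ⊗ conjM A) ≈M I

  -- γ' with γ'(x) = a(x) + c(x) e (x ∈ V♭), γ'(e) = b + d e
  block : ∀ {m} → Mat m m → Vect m → Vect m → Carrier → Mat (suc m) (suc m)
  block a b cr d zero    zero    = d
  block a b cr d zero    (suc j) = cr j
  block a b cr d (suc i) zero    = b i
  block a b cr d (suc i) (suc j) = a i j

  ext : ∀ {m} → Mat m m → Mat (suc m) (suc m)
  ext h = block h (λ _ → 0#) (λ _ → 0#) 1#

  IsGL₀ : ∀ {m} → Mat m m → Mat m m → Set ℓ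
  IsGL₀ h hi = IsF₀M h × IsF₀M hi × (h ⊗ hi) ≈M I × (hi ⊗ h) ≈M I

  -- γ = a + b c / (1 - d), b₁ = b/(1-d), c₁ = c/(1-d), where u = (1-d)⁻¹
  gam : ∀ {m} → Mat m m → Vect m → Vect m → Carrier → Mat m m
  gam a b cr u i j = a i j + (u * (b i * cr j))

  b₁ : ∀ {m} → Vect m → Carrier → Vect m
  b₁ b u i = u * b i

  c₁ : ∀ {m} → Vect m → Carrier → Vect m
  c₁ cr u j = u * cr j

  record Gamma' (m : ℕ) : Set (c ⊔ ℓ) where
    field
      a   : Mat m m
      b   : Vect m
      cr  : Vect m
      d   : Carrier
      u   : Carrier
      inS : InS (block a b cr d)
      d≉1 : ¬ (d ≈ 1#)
      u-inv : ((1# - d) * u) ≈ 1#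
    γ' : Mat (suc m) (suc m)
    γ' = block a b cr d
    γ : Mat m m
    γ = gam a b cr u
    β₁ : Vect m
    β₁ = b₁ b u
    χ₁ : Vect m
    χ₁ = c₁ cr u

  IsTwisting : ∀ {m} → Mat m m → Mat m m → Mat m m → Set ℓ
  IsTwisting γ B Bi = (B ⊗ Bi) ≈M I × (Bi ⊗ B) ≈M I
                    × γ ≈M (B ⊗ conjM Bi) × γ ≈M (conjM Bi ⊗ B)

  b₂ : ∀ {m} → Gamma' m → Mat m m → Vect m
  b₂ G Bi = Bi ▷ Gamma'.β₁ G

  c₂ : ∀ {m} → Gamma' m → Mat m m → Vect m
  c₂ G B = Gamma'.χ₁ G ◁ conjM B

  Conjugate : ∀ {m} → Mat (suc m) (suc m) → Mat (suc m) (suc m) → Set (c ⊔ ℓ)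
  Conjugate {m} A A' = Σ (Mat m m) λ h → Σ (Mat m m) λ hi →
    IsGL₀ h hi × A' ≈M ((ext hi ⊗ A) ⊗ ext h)

  SameOrbit : ∀ {m} → Mat m m × Vect m × Vect m → Mat m m × Vect m × Vect m → Set (c ⊔ ℓ)
  SameOrbit {m} (γ , b , cr) (γ₂ , b₂' , c₂') = Σ (Mat m m) λ h → Σ (Mat m m) λ hi →
    IsGL₀ h hi × γ₂ ≈M ((hi ⊗ γ) ⊗ h) × b₂' ≈V (hi ▷ b) × c₂' ≈V (cr ◁ h)

module Submission where

-- Writing γ' γ̄' = 1 in blocks gives a ā + b c̄ = 1, a b̄ + d̄ b = 0, c ā + d c̄ = 0 and
-- c b̄ + d d̄ = 1, and γ̄' γ' = 1 gives the conjugate relations.  Substituting them,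
-- γ b̄ = κ b and c̄ γ = κ c for the scalar κ = u(1 - d d̄) - d̄, and
-- γ γ̄ = 1 + (ū κ - (1 + u d)) b c̄.  Since u = (1 - d)⁻¹, both ū κ and 1 + u d equal u,
-- whence γ γ̄ = 1, γ b̄₁ = b₁ and c̄₁ γ = c₁.  The twisting relations γ = B B̄⁻¹ = B̄⁻¹ B
-- then make b₂ = B⁻¹ b₁ and c₂ = c₁ B̄ rational and give B̄ γ^(i+1) B⁻¹ = γ^i.
-- For (2): conjugating γ' by h conjugates (γ, b₁, c₁) by h, and h⁻¹ B h is a twisting
-- element for h⁻¹ γ h whose triple is the h-translate of the triple of B.  Two twisting
-- elements B, B′ of the same γ differ by the rational element B⁻¹ B′, which commutes with γ
-- and carries the triple of B to that of B′.

open import Level using (Level; 0ℓ)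
open import Algebra.Bundles using (CommutativeRing; RawRing; Monoid)
import Algebra.Properties.Monoid
import Algebra.Solver.Ring.AlmostCommutativeRing as ACR
open import Data.Fin using (Fin; zero; suc)
open import Data.Integer using (ℤ; -[1+_]) renaming (_+_ to _+ℤ_; +_ to ⁺_)
open import Data.Maybe using (Maybe; just; nothing)
open import Data.Nat as ℕ using (ℕ; zero; suc; _∸_)
open import Data.Nat.Properties as ℕ using (≤-total; m≤n⇒m∸n≡0; m∸n+n≡m)
open import Data.Product using (_×_; _,_; proj₁; proj₂)
open import Data.Sum using (inj₁; inj₂)
import Data.Vec.Functional.Relation.Binary.Equality.Setoid as PointwiseEquality
open import Relation.Binary.Bundles using (Setoid)
open import Relation.Binary.PropositionalEquality as ≡ using (_≡_)
import Relation.Binary.Reasoning.Setoid as SetoidReasoning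
open import Relation.Nullary using (yes; no)

open import Defs

-- The library's ring solver needs a coefficient ring with decidable equality mapping into
-- the given ring; for an arbitrary commutative ring we use ℤ, as differences of naturals.
module IntegerCoefficientRingSolver {c ℓ : Level} (R : CommutativeRing c ℓ) where
  open CommutativeRing R
  open import Algebra.Properties.Ring ring using (-‿distribˡ-*; -‿involutive; -‿+-comm; x[y-z]≈xy-xz; -0#≈0#)
  open import Algebra.Properties.AbelianGroup +-abelianGroup using (⁻¹-anti-homo‿-)
  open import Algebra.Properties.CommutativeSemigroup +-commutativeSemigroup using (interchange)
  open import Algebra.Properties.Semiring.Mult.TCOptimised semiring using (×-homo-+; ×1-homo-*) renaming (_×_ to _·_)
  open import Relation.Binary.Reasoning.Setoid setoid

  private
    -- The difference p − n, kept with min(p, n) = 0 so that equal coefficients are equal on the nose.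
    Diff : Set
    Diff = ℕ × ℕ

    -- Split on n so that the constants 0 and 1 denote 0# and 1# on the nose.
    ⟦_⟧ : Diff → Carrier
    ⟦ p , zero ⟧  = p · 1#
    ⟦ p , suc n ⟧ = p · 1# - suc n · 1#

    ⟦⟧-sub : ∀ p n → ⟦ p , n ⟧ ≈ p · 1# - n · 1#
    ⟦⟧-sub p zero    = sym (trans (+-congˡ -0#≈0#) (+-identityʳ _))
    ⟦⟧-sub p (suc n) = refl

    normalise : Diff → Diff
    normalise (p , n) = (p ∸ n , n ∸ p)

    sub-+-cancelʳ : ∀ x y z → (x + z) - (y + z) ≈ x - y
    sub-+-cancelʳ x y z = begin
      (x + z) - (y + z)       ≈⟨ +-congˡ (sym (-‿+-comm y z)) ⟩
      (x + z) + (- y + - z)   ≈⟨ interchange x z (- y) (- z) ⟩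
      (x - y) + (z - z)       ≈⟨ +-congˡ (-‿inverseʳ z) ⟩
      (x - y) + 0#            ≈⟨ +-identityʳ _ ⟩
      x - y                   ∎

    ⟦⟧-+-cancelʳ : ∀ p n k → ⟦ p ℕ.+ k , n ℕ.+ k ⟧ ≈ ⟦ p , n ⟧
    ⟦⟧-+-cancelʳ p n k = begin
      ⟦ p ℕ.+ k , n ℕ.+ k ⟧                     ≈⟨ ⟦⟧-sub (p ℕ.+ k) (n ℕ.+ k) ⟩
      (p ℕ.+ k) · 1# - (n ℕ.+ k) · 1#           ≈⟨ +-cong (×-homo-+ 1# p k) (-‿cong (×-homo-+ 1# n k)) ⟩
      (p · 1# + k · 1#) - (n · 1# + k · 1#)     ≈⟨ sub-+-cancelʳ (p · 1#) (n · 1#) (k · 1#) ⟩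
      p · 1# - n · 1#                           ≈⟨ ⟦⟧-sub p n ⟨
      ⟦ p , n ⟧                                 ∎

    normalise-correct : ∀ d → ⟦ normalise d ⟧ ≈ ⟦ d ⟧
    normalise-correct (p , n) with ≤-total p n
    ... | inj₁ p≤n rewrite m≤n⇒m∸n≡0 p≤n =
      trans (sym (⟦⟧-+-cancelʳ 0 (n ∸ p) p)) (reflexive (≡.cong (λ k → ⟦ p , k ⟧) (m∸n+n≡m p≤n)))
    ... | inj₂ n≤p rewrite m≤n⇒m∸n≡0 n≤p =
      trans (sym (⟦⟧-+-cancelʳ (p ∸ n) 0 n)) (reflexive (≡.cong (λ k → ⟦ k , n ⟧) (m∸n+n≡m n≤p)))

    Coefficients : RawRing 0ℓ 0ℓ
    Coefficients = record
      { Carrier = Diff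
      ; _≈_ = _≡_
      ; _+_ = λ { (p , n) (p' , n') → normalise (p ℕ.+ p' , n ℕ.+ n') }
      ; _*_ = λ { (p , n) (p' , n') → normalise (p ℕ.* p' ℕ.+ n ℕ.* n' , p ℕ.* n' ℕ.+ n ℕ.* p') }
      ; -_ = λ { (p , n) → (n , p) }
      ; 0# = (0 , 0)
      ; 1# = (1 , 0)
      }

    sub-*-sub : ∀ x y z w → (x - y) * (z - w) ≈ (x * z + y * w) - (x * w + y * z)
    sub-*-sub x y z w = begin
      (x - y) * (z - w)                           ≈⟨ distribʳ _ _ _ ⟩
      x * (z - w) + (- y) * (z - w)               ≈⟨ +-cong (x[y-z]≈xy-xz x z w) (x[y-z]≈xy-xz (- y) z w) ⟩
      (x * z - x * w) + (- y * z - - y * w)       ≈⟨ +-congˡ (+-cong (sym (-‿distribˡ-* y z))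
                                                        (-‿cong (sym (-‿distribˡ-* y w)))) ⟩
      (x * z - x * w) + (- (y * z) - - (y * w))   ≈⟨ +-congˡ (trans (+-congˡ (-‿involutive _)) (+-comm _ _)) ⟩
      (x * z - x * w) + (y * w - y * z)           ≈⟨ interchange _ _ _ _ ⟩
      (x * z + y * w) + (- (x * w) - y * z)       ≈⟨ +-congˡ (-‿+-comm _ _) ⟩
      (x * z + y * w) - (x * w + y * z)           ∎

    morphism : Coefficients ACR.-Raw-AlmostCommutative⟶ ACR.fromCommutativeRing R
    morphism = record
      { ⟦_⟧ = ⟦_⟧
      ; +-homo = λ { (p , n) (p' , n') → begin
          ⟦ normalise (p ℕ.+ p' , n ℕ.+ n') ⟧                   ≈⟨ normalise-correct (p ℕ.+ p' , n ℕ.+ n') ⟩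
          ⟦ p ℕ.+ p' , n ℕ.+ n' ⟧                               ≈⟨ ⟦⟧-sub (p ℕ.+ p') (n ℕ.+ n') ⟩
          (p ℕ.+ p') · 1# - (n ℕ.+ n') · 1#                     ≈⟨ +-cong (×-homo-+ 1# p p') (-‿cong (×-homo-+ 1# n n')) ⟩
          (p · 1# + p' · 1#) - (n · 1# + n' · 1#)               ≈⟨ +-congˡ (sym (-‿+-comm _ _)) ⟩
          (p · 1# + p' · 1#) + (- (n · 1#) + - (n' · 1#))       ≈⟨ interchange _ _ _ _ ⟩
          (p · 1# - n · 1#) + (p' · 1# - n' · 1#)               ≈⟨ +-cong (⟦⟧-sub p n) (⟦⟧-sub p' n') ⟨
          ⟦ p , n ⟧ + ⟦ p' , n' ⟧                               ∎ }
      ; *-homo = λ { (p , n) (p' , n') → begin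
          ⟦ normalise (p ℕ.* p' ℕ.+ n ℕ.* n' , p ℕ.* n' ℕ.+ n ℕ.* p') ⟧
            ≈⟨ normalise-correct (p ℕ.* p' ℕ.+ n ℕ.* n' , p ℕ.* n' ℕ.+ n ℕ.* p') ⟩
          ⟦ p ℕ.* p' ℕ.+ n ℕ.* n' , p ℕ.* n' ℕ.+ n ℕ.* p' ⟧
            ≈⟨ ⟦⟧-sub (p ℕ.* p' ℕ.+ n ℕ.* n') (p ℕ.* n' ℕ.+ n ℕ.* p') ⟩
          (p ℕ.* p' ℕ.+ n ℕ.* n') · 1# - (p ℕ.* n' ℕ.+ n ℕ.* p') · 1#
            ≈⟨ +-cong (trans (×-homo-+ 1# (p ℕ.* p') (n ℕ.* n')) (+-cong (×1-homo-* p p') (×1-homo-* n n')))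
                      (-‿cong (trans (×-homo-+ 1# (p ℕ.* n') (n ℕ.* p')) (+-cong (×1-homo-* p n') (×1-homo-* n p')))) ⟩
          (p · 1# * (p' · 1#) + n · 1# * (n' · 1#)) - (p · 1# * (n' · 1#) + n · 1# * (p' · 1#))
            ≈⟨ sub-*-sub _ _ _ _ ⟨
          (p · 1# - n · 1#) * (p' · 1# - n' · 1#)               ≈⟨ *-cong (⟦⟧-sub p n) (⟦⟧-sub p' n') ⟨
          ⟦ p , n ⟧ * ⟦ p' , n' ⟧                               ∎ }
      ; -‿homo = λ { (p , n) → trans (⟦⟧-sub n p)
                   (trans (sym (⁻¹-anti-homo‿- (p · 1#) (n · 1#))) (-‿cong (sym (⟦⟧-sub p n)))) }
      ; 0-homo = refl
      ; 1-homo = refl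
      }

    _≟⟦⟧_ : ∀ d d' → Maybe (⟦ d ⟧ ≈ ⟦ d' ⟧)
    (p , n) ≟⟦⟧ (p' , n') with p ℕ.+ n' ℕ.≟ p' ℕ.+ n
    ... | no _ = nothing
    ... | yes eq = just (begin
      ⟦ p , n ⟧                   ≈⟨ sym (⟦⟧-+-cancelʳ p n n') ⟩
      ⟦ p ℕ.+ n' , n ℕ.+ n' ⟧     ≈⟨ reflexive (≡.cong₂ (λ s t → ⟦ s , t ⟧) eq (ℕ.+-comm n n')) ⟩
      ⟦ p' ℕ.+ n , n' ℕ.+ n ⟧     ≈⟨ ⟦⟧-+-cancelʳ p' n' n ⟩
      ⟦ p' , n' ⟧                 ∎)

  open import Algebra.Solver.Ring Coefficients (ACR.fromCommutativeRing R) morphism _≟⟦⟧_ public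

  :0 :1 : ∀ {n} → Polynomial n
  :0 = con (0 , 0)
  :1 = con (1 , 0)


module _ {c ℓ : Level} (R : CommutativeRing c ℓ) where
  open CommutativeRing R
  open IntegerCoefficientRingSolver R using (solve; _:=_; _:+_; _:*_; _:-_; :1)
  open import Relation.Binary.Reasoning.Setoid setoid

  x+y≈z⇒y≈z-x : ∀ {x y z} → x + y ≈ z → y ≈ z - x
  x+y≈z⇒y≈z-x {x} {y} x+y≈z = trans (solve 2 (λ x y → y := (x :+ y) :- x) refl x y) (+-congʳ x+y≈z)

  y[x[1-st]-t]≈x : ∀ {s t x y} → (1# - s) * x ≈ 1# → (1# - t) * y ≈ 1# →
                   y * (x * (1# - s * t) - t) ≈ x
  y[x[1-st]-t]≈x {s} {t} {x} {y} sx≈1 ty≈1 = begin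
    y * (x * (1# - s * t) - t)                           ≈⟨ regroup s t x y ⟩
    x * ((1# - t) * y) + (y * t) * ((1# - s) * x - 1#)   ≈⟨ +-cong (*-congˡ ty≈1) (*-congˡ (+-congʳ sx≈1)) ⟩
    x * 1# + (y * t) * (1# - 1#)                         ≈⟨ simplify x (y * t) ⟩
    x                                                    ∎
    where
    regroup : ∀ s t x y → y * (x * (1# - s * t) - t) ≈ x * ((1# - t) * y) + (y * t) * ((1# - s) * x - 1#)
    regroup = solve 4 (λ s t x y → y :* (x :* (:1 :- s :* t) :- t)
                                   := x :* ((:1 :- t) :* y) :+ (y :* t) :* ((:1 :- s) :* x :- :1)) refl
    simplify : ∀ x z → x * 1# + z * (1# - 1#) ≈ x
    simplify = solve 2 (λ x z → x :* :1 :+ z :* (:1 :- :1) := x) refl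

  inverse-unique : ∀ {x y z} → x * y ≈ 1# → x * z ≈ 1# → y ≈ z
  inverse-unique {x} {y} {z} xy≈1 xz≈1 = begin
    y              ≈⟨ *-identityʳ y ⟨
    y * 1#         ≈⟨ *-congˡ xz≈1 ⟨
    y * (x * z)    ≈⟨ solve 3 (λ x y z → y :* (x :* z) := (x :* y) :* z) refl x y z ⟩
    (x * y) * z    ≈⟨ *-congʳ xy≈1 ⟩
    1# * z         ≈⟨ *-identityˡ z ⟩
    z              ∎

module _ {c ℓ : Level} (F : FieldInv c ℓ) where
  open FieldInv F hiding (zero)
  open Ops F
  open IntegerCoefficientRingSolver commRing using (solve; _:=_; _:+_; _:*_; _:-_; :0; :1)
  open import Algebra.Properties.Ring ring using (x+x≈x⇒x≈0; +-inverseʳ-unique)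
  open PointwiseEquality setoid using (≋-setoid)

  module ≈-Reasoning = SetoidReasoning setoid

  -- Finite sums and the bar involution

  σ-0# : σ 0# ≈ 0#
  σ-0# = x+x≈x⇒x≈0 (σ 0#) (trans (sym (σ-+ 0# 0#)) (σ-cong (+-identityʳ 0#)))

  σ-neg : ∀ x → σ (- x) ≈ - σ x
  σ-neg x = +-inverseʳ-unique (σ x) (σ (- x))
            (trans (sym (σ-+ x (- x))) (trans (σ-cong (-‿inverseʳ x)) σ-0#))

  σ-[1-x] : ∀ x → σ (1# - x) ≈ 1# - σ x
  σ-[1-x] x = trans (σ-+ 1# (- x)) (+-cong σ-1 (σ-neg x))

  ∑-cong : ∀ {n} {f g : Fin n → Carrier} → (∀ i → f i ≈ g i) → ∑ f ≈ ∑ g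
  ∑-cong {zero}  f≈g = refl
  ∑-cong {suc n} f≈g = +-cong (f≈g zero) (∑-cong (λ i → f≈g (suc i)))

  ∑-zero : ∀ {n} {f : Fin n → Carrier} → (∀ i → f i ≈ 0#) → ∑ f ≈ 0#
  ∑-zero {zero}  f≈0 = refl
  ∑-zero {suc n} f≈0 = trans (+-cong (f≈0 zero) (∑-zero (λ i → f≈0 (suc i)))) (+-identityʳ 0#)

  ∑-distrib-+ : ∀ {n} (f g : Fin n → Carrier) → ∑ (λ i → f i + g i) ≈ ∑ f + ∑ g
  ∑-distrib-+ {zero}  f g = sym (+-identityʳ 0#)
  ∑-distrib-+ {suc n} f g = trans (+-congˡ (∑-distrib-+ (λ i → f (suc i)) (λ i → g (suc i))))
                                  (solve 4 (λ a b x y → (a :+ b) :+ (x :+ y) := (a :+ x) :+ (b :+ y)) refl _ _ _ _)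

  *-distribˡ-∑ : ∀ {n} x (f : Fin n → Carrier) → x * ∑ f ≈ ∑ (λ i → x * f i)
  *-distribˡ-∑ {zero}  x f = zeroʳ x
  *-distribˡ-∑ {suc n} x f = trans (distribˡ x (f zero) _) (+-congˡ (*-distribˡ-∑ x (λ i → f (suc i))))

  *-distribʳ-∑ : ∀ {n} x (f : Fin n → Carrier) → ∑ f * x ≈ ∑ (λ i → f i * x)
  *-distribʳ-∑ x f = trans (*-comm _ x) (trans (*-distribˡ-∑ x f) (∑-cong (λ i → *-comm x (f i))))

  ∑-comm : ∀ {n k} (f : Fin n → Fin k → Carrier) → ∑ (λ i → ∑ (f i)) ≈ ∑ (λ j → ∑ (λ i → f i j))
  ∑-comm {zero} {k} f = sym (∑-zero {k} (λ _ → refl))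
  ∑-comm {suc n} f = trans (+-congˡ (∑-comm (λ i → f (suc i))))
                           (sym (∑-distrib-+ (f zero) (λ j → ∑ (λ i → f (suc i) j))))

  σ-∑ : ∀ {n} (f : Fin n → Carrier) → σ (∑ f) ≈ ∑ (λ i → σ (f i))
  σ-∑ {zero}  f = σ-0#
  σ-∑ {suc n} f = trans (σ-+ _ _) (+-congˡ (σ-∑ (λ i → f (suc i))))

  1#*x+∑0#*≈x : ∀ {n} x (f : Fin n → Carrier) → 1# * x + ∑ (λ l → 0# * f l) ≈ x
  1#*x+∑0#*≈x x f = trans (+-cong (*-identityˡ x) (∑-zero (λ l → zeroˡ (f l)))) (+-identityʳ x)

  x*1#+∑*0#≈x : ∀ {n} x (f : Fin n → Carrier) → x * 1# + ∑ (λ l → f l * 0#) ≈ x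
  x*1#+∑*0#≈x x f = trans (+-cong (*-identityʳ x) (∑-zero (λ l → zeroʳ (f l)))) (+-identityʳ x)

  ∑-Iˡ : ∀ {n} (v : Vect n) i → ∑ (λ l → I i l * v l) ≈ v i
  ∑-Iˡ v zero    = 1#*x+∑0#*≈x (v zero) (λ l → v (suc l))
  ∑-Iˡ v (suc i) = trans (+-cong (zeroˡ _) (∑-Iˡ (λ l → v (suc l)) i)) (+-identityˡ _)

  ∑-Iʳ : ∀ {n} (v : Vect n) j → ∑ (λ l → v l * I l j) ≈ v j
  ∑-Iʳ v zero    = x*1#+∑*0#≈x (v zero) (λ l → v (suc l))
  ∑-Iʳ v (suc j) = trans (+-cong (zeroʳ _) (∑-Iʳ (λ l → v (suc l)) j)) (+-identityˡ _)

  Vect-setoid : ℕ → Setoid c ℓ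
  Vect-setoid = ≋-setoid

  Mat-setoid : ℕ → ℕ → Setoid c ℓ
  Mat-setoid m n = PointwiseEquality.≋-setoid (≋-setoid n) m

  module ≈V {n} = Setoid (Vect-setoid n)
  module ≈M {m n} = Setoid (Mat-setoid m n)
  module ≈V-Reasoning {n} = SetoidReasoning (Vect-setoid n)
  module ≈M-Reasoning {m n} = SetoidReasoning (Mat-setoid m n)


  ⊗-cong : ∀ {m n k} {A A' : Mat m n} {B B' : Mat n k} → A ≈M A' → B ≈M B' → (A ⊗ B) ≈M (A' ⊗ B')
  ⊗-cong A≈A' B≈B' i j = ∑-cong (λ l → *-cong (A≈A' i l) (B≈B' l j))

  ⊗-congˡ : ∀ {m n k} (A : Mat m n) {B B' : Mat n k} → B ≈M B' → (A ⊗ B) ≈M (A ⊗ B')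
  ⊗-congˡ A B≈B' = ⊗-cong (λ _ _ → refl) B≈B'

  ⊗-congʳ : ∀ {m n k} (B : Mat n k) {A A' : Mat m n} → A ≈M A' → (A ⊗ B) ≈M (A' ⊗ B)
  ⊗-congʳ B A≈A' = ⊗-cong A≈A' (λ _ _ → refl)

  ▷-cong : ∀ {m n} {A A' : Mat m n} {v v' : Vect n} → A ≈M A' → v ≈V v' → (A ▷ v) ≈V (A' ▷ v')
  ▷-cong A≈A' v≈v' i = ∑-cong (λ l → *-cong (A≈A' i l) (v≈v' l))

  ◁-cong : ∀ {m n} {r r' : Vect m} {A A' : Mat m n} → r ≈V r' → A ≈M A' → (r ◁ A) ≈V (r' ◁ A')
  ◁-cong r≈r' A≈A' j = ∑-cong (λ l → *-cong (r≈r' l) (A≈A' l j))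

  ⟪⟫-cong : ∀ {n} {r r' v v' : Vect n} → r ≈V r' → v ≈V v' → ⟪ r , v ⟫ ≈ ⟪ r' , v' ⟫
  ⟪⟫-cong r≈r' v≈v' = ∑-cong (λ l → *-cong (r≈r' l) (v≈v' l))

  ⟪◁⟫≈⟪▷⟫ : ∀ {m n} (r : Vect m) (A : Mat m n) (v : Vect n) → ⟪ r ◁ A , v ⟫ ≈ ⟪ r , A ▷ v ⟫
  ⟪◁⟫≈⟪▷⟫ r A v = begin
    ∑ (λ j → ∑ (λ l → r l * A l j) * v j)    ≈⟨ ∑-cong (λ j → *-distribʳ-∑ (v j) (λ l → r l * A l j)) ⟩
    ∑ (λ j → ∑ (λ l → (r l * A l j) * v j))  ≈⟨ ∑-comm (λ j l → (r l * A l j) * v j) ⟩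
    ∑ (λ l → ∑ (λ j → (r l * A l j) * v j))  ≈⟨ ∑-cong (λ l → ∑-cong (λ j → *-assoc (r l) (A l j) (v j))) ⟩
    ∑ (λ l → ∑ (λ j → r l * (A l j * v j)))  ≈⟨ ∑-cong (λ l → *-distribˡ-∑ (r l) (λ j → A l j * v j)) ⟨
    ∑ (λ l → r l * ∑ (λ j → A l j * v j))    ∎
    where open ≈-Reasoning

  ⊗-assoc : ∀ {m n k p} (A : Mat m n) (B : Mat n k) (C : Mat k p) → ((A ⊗ B) ⊗ C) ≈M (A ⊗ (B ⊗ C))
  ⊗-assoc A B C i j = ⟪◁⟫≈⟪▷⟫ (A i) B (λ l → C l j)

  ▷-⊗ : ∀ {m n k} (A : Mat m n) (B : Mat n k) (v : Vect k) → ((A ⊗ B) ▷ v) ≈V (A ▷ (B ▷ v))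
  ▷-⊗ A B v i = ⟪◁⟫≈⟪▷⟫ (A i) B v

  ◁-⊗ : ∀ {m n k} (r : Vect m) (A : Mat m n) (B : Mat n k) → (r ◁ (A ⊗ B)) ≈V ((r ◁ A) ◁ B)
  ◁-⊗ r A B j = sym (⟪◁⟫≈⟪▷⟫ r A (λ l → B l j))

  ⊗-identityˡ : ∀ {m n} (A : Mat m n) → (I ⊗ A) ≈M A
  ⊗-identityˡ A i j = ∑-Iˡ (λ l → A l j) i

  ⊗-identityʳ : ∀ {m n} (A : Mat m n) → (A ⊗ I) ≈M A
  ⊗-identityʳ A i j = ∑-Iʳ (A i) j

  Mat-monoid : ℕ → Monoid c ℓ
  Mat-monoid m = record
    { Carrier = Mat m m ; _≈_ = _≈M_ ; _∙_ = _⊗_ ; ε = I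
    ; isMonoid = record
      { isSemigroup = record
        { isMagma = record { isEquivalence = Setoid.isEquivalence (Mat-setoid m m) ; ∙-cong = ⊗-cong }
        ; assoc = ⊗-assoc }
      ; identity = ⊗-identityˡ , ⊗-identityʳ } }

  conjM-cong : ∀ {m n} {A B : Mat m n} → A ≈M B → conjM A ≈M conjM B
  conjM-cong A≈B i j = σ-cong (A≈B i j)

  conjM-involutive : ∀ {m n} (A : Mat m n) → conjM (conjM A) ≈M A
  conjM-involutive A i j = σ-invol (A i j)

  conjM-I : ∀ {n} → conjM (I {n}) ≈M I
  conjM-I zero    zero    = σ-1
  conjM-I zero    (suc j) = σ-0#
  conjM-I (suc i) zero    = σ-0#
  conjM-I (suc i) (suc j) = conjM-I i j

  σ-⟪⟫ : ∀ {n} (x y : Vect n) → σ ⟪ x , y ⟫ ≈ ⟪ conjV x , conjV y ⟫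
  σ-⟪⟫ x y = trans (σ-∑ (λ l → x l * y l)) (∑-cong (λ l → σ-* (x l) (y l)))

  conjM-⊗ : ∀ {m n k} (A : Mat m n) (B : Mat n k) → conjM (A ⊗ B) ≈M (conjM A ⊗ conjM B)
  conjM-⊗ A B i j = σ-⟪⟫ (A i) (λ l → B l j)

  conjV-▷ : ∀ {m n} (A : Mat m n) (v : Vect n) → conjV (A ▷ v) ≈V (conjM A ▷ conjV v)
  conjV-▷ A v i = σ-⟪⟫ (A i) v

  conjV-◁ : ∀ {m n} (r : Vect m) (A : Mat m n) → conjV (r ◁ A) ≈V (conjV r ◁ conjM A)
  conjV-◁ r A j = σ-⟪⟫ r (λ l → A l j)

  conjM-inverse : ∀ {m} {X Y : Mat m m} → (X ⊗ Y) ≈M I → (conjM X ⊗ conjM Y) ≈M I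
  conjM-inverse {X = X} {Y} XY≈I = ≈M.trans (≈M.sym (conjM-⊗ X Y)) (≈M.trans (conjM-cong XY≈I) conjM-I)

  InS-conj : ∀ {n} {A : Mat n n} → InS A → (conjM A ⊗ A) ≈M I
  InS-conj {A = A} AĀ≈I = begin
    conjM A ⊗ A                   ≈⟨ ⊗-congˡ (conjM A) (conjM-involutive A) ⟨
    conjM A ⊗ conjM (conjM A)     ≈⟨ conjM-⊗ A (conjM A) ⟨
    conjM (A ⊗ conjM A)           ≈⟨ conjM-cong AĀ≈I ⟩
    conjM I                       ≈⟨ conjM-I ⟩
    I                             ∎
    where open ≈M-Reasoning

  -- Rank-one updates

  infixl 6 _+M_

  _+M_ : ∀ {m n} → Mat m n → Mat m n → Mat m n
  (A +M B) i j = A i j + B i j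

  -- gam a b cr u is literally a +M rankOne u b cr.
  rankOne : ∀ {m n} → Carrier → Vect m → Vect n → Mat m n
  rankOne u b r i j = u * (b i * r j)

  +M-cong : ∀ {m n} {A A' B B' : Mat m n} → A ≈M A' → B ≈M B' → (A +M B) ≈M (A' +M B')
  +M-cong A≈A' B≈B' i j = +-cong (A≈A' i j) (B≈B' i j)

  rankOne-cong : ∀ {m n} {u u'} {b b' : Vect m} {r r' : Vect n} →
                 u ≈ u' → b ≈V b' → r ≈V r' → rankOne u b r ≈M rankOne u' b' r'
  rankOne-cong u≈u' b≈b' r≈r' i j = *-cong u≈u' (*-cong (b≈b' i) (r≈r' j))

  ▷-scale : ∀ {m n} k (A : Mat m n) (v : Vect n) → (A ▷ (λ l → k * v l)) ≈V (λ i → k * (A ▷ v) i)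
  ▷-scale k A v i = trans (∑-cong (λ l → solve 3 (λ a k v → a :* (k :* v) := k :* (a :* v)) refl (A i l) k (v l)))
                          (sym (*-distribˡ-∑ k (λ l → A i l * v l)))

  ◁-scale : ∀ {m n} k (r : Vect m) (A : Mat m n) → ((λ l → k * r l) ◁ A) ≈V (λ j → k * (r ◁ A) j)
  ◁-scale k r A j = trans (∑-cong (λ l → *-assoc k (r l) (A l j))) (sym (*-distribˡ-∑ k (λ l → r l * A l j)))

  ▷-+rankOne : ∀ {m n} (A : Mat m n) u (b : Vect m) (r v : Vect n) →
               ((A +M rankOne u b r) ▷ v) ≈V (λ i → (A ▷ v) i + u * (b i * ⟪ r , v ⟫))
  ▷-+rankOne A u b r v i = begin
    ∑ (λ l → (A i l + u * (b i * r l)) * v l)        ≈⟨ ∑-cong (λ l → expand (A i l) u (b i) (r l) (v l)) ⟩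
    ∑ (λ l → A i l * v l + (u * b i) * (r l * v l))  ≈⟨ ∑-distrib-+ (λ l → A i l * v l) _ ⟩
    (A ▷ v) i + ∑ (λ l → (u * b i) * (r l * v l))    ≈⟨ +-congˡ (*-distribˡ-∑ (u * b i) (λ l → r l * v l)) ⟨
    (A ▷ v) i + (u * b i) * ⟪ r , v ⟫                ≈⟨ +-congˡ (*-assoc u (b i) _) ⟩
    (A ▷ v) i + u * (b i * ⟪ r , v ⟫)                ∎
    where
    open ≈-Reasoning
    expand : ∀ a u b r v → (a + u * (b * r)) * v ≈ a * v + (u * b) * (r * v)
    expand = solve 5 (λ a u b r v → (a :+ u :* (b :* r)) :* v := a :* v :+ (u :* b) :* (r :* v)) refl

  ◁-+rankOne : ∀ {m n} (r : Vect m) (A : Mat m n) u (b : Vect m) (c : Vect n) →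
               (r ◁ (A +M rankOne u b c)) ≈V (λ j → (r ◁ A) j + u * (⟪ r , b ⟫ * c j))
  ◁-+rankOne r A u b c j = begin
    ∑ (λ l → r l * (A l j + u * (b l * c j)))        ≈⟨ ∑-cong (λ l → expand (r l) (A l j) u (b l) (c j)) ⟩
    ∑ (λ l → r l * A l j + (u * c j) * (r l * b l))  ≈⟨ ∑-distrib-+ (λ l → r l * A l j) _ ⟩
    (r ◁ A) j + ∑ (λ l → (u * c j) * (r l * b l))    ≈⟨ +-congˡ (*-distribˡ-∑ (u * c j) (λ l → r l * b l)) ⟨
    (r ◁ A) j + (u * c j) * ⟪ r , b ⟫                ≈⟨ +-congˡ (swap u (c j) _) ⟩
    (r ◁ A) j + u * (⟪ r , b ⟫ * c j)                ∎
    where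
    open ≈-Reasoning
    swap : ∀ u c x → (u * c) * x ≈ u * (x * c)
    swap = solve 3 (λ u c x → (u :* c) :* x := u :* (x :* c)) refl
    expand : ∀ r a u b c → r * (a + u * (b * c)) ≈ r * a + (u * c) * (r * b)
    expand = solve 5 (λ r a u b c → r :* (a :+ u :* (b :* c)) := r :* a :+ (u :* c) :* (r :* b)) refl

  ⊗-+rankOne : ∀ {m n k} (A : Mat m n) (B : Mat n k) u (b : Vect n) (c : Vect k) →
               (A ⊗ (B +M rankOne u b c)) ≈M ((A ⊗ B) +M rankOne u (A ▷ b) c)
  ⊗-+rankOne A B u b c i = ◁-+rankOne (A i) B u b c

  +rankOne-⊗ : ∀ {m n k} (B : Mat m n) u (b : Vect m) (c : Vect n) (A : Mat n k) →
               ((B +M rankOne u b c) ⊗ A) ≈M ((B ⊗ A) +M rankOne u b (c ◁ A))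
  +rankOne-⊗ B u b c A i j = ▷-+rankOne B u b c (λ l → A l j) i

  conjM-+rankOne : ∀ {m n} (A : Mat m n) u (b : Vect m) (c : Vect n) →
                   conjM (A +M rankOne u b c) ≈M (conjM A +M rankOne (σ u) (conjV b) (conjV c))
  conjM-+rankOne A u b c i j =
    trans (σ-+ _ _) (+-congˡ (trans (σ-* u _) (*-congˡ (σ-* (b i) (c j)))))

  private
    module ⊗-Props {m : ℕ} = Algebra.Properties.Monoid (Mat-monoid m)

  IsF₀M-⊗ : ∀ {m} {A B : Mat m m} → IsF₀M A → IsF₀M B → IsF₀M (A ⊗ B)
  IsF₀M-⊗ {A = A} {B} Ā≈A B̄≈B i j = trans (conjM-⊗ A B i j) (⊗-cong Ā≈A B̄≈B i j)

  IsGL₀-⊗ : ∀ {m} {h h⁻¹ k k⁻¹ : Mat m m} → IsGL₀ h h⁻¹ → IsGL₀ k k⁻¹ → IsGL₀ (h ⊗ k) (k⁻¹ ⊗ h⁻¹)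
  IsGL₀-⊗ {h = h} {h⁻¹} {k} {k⁻¹} (h-F₀ , h⁻¹-F₀ , hh⁻¹≈I , h⁻¹h≈I)
                                  (k-F₀ , k⁻¹-F₀ , kk⁻¹≈I , k⁻¹k≈I) =
    IsF₀M-⊗ h-F₀ k-F₀ , IsF₀M-⊗ k⁻¹-F₀ h⁻¹-F₀ ,
    ≈M.trans (⊗-Props.cancelᶜ kk⁻¹≈I h h⁻¹) hh⁻¹≈I ,
    ≈M.trans (⊗-Props.cancelᶜ h⁻¹h≈I k⁻¹ k) k⁻¹k≈I

  SameOrbit-trans : ∀ {m} {γ₁ γ₂ γ₃ : Mat m m} {b₁ b₂ b₃ c₁ c₂ c₃ : Vect m} →
                    SameOrbit (γ₁ , b₁ , c₁) (γ₂ , b₂ , c₂) → SameOrbit (γ₂ , b₂ , c₂) (γ₃ , b₃ , c₃) →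
                    SameOrbit (γ₁ , b₁ , c₁) (γ₃ , b₃ , c₃)
  SameOrbit-trans {γ₁ = γ₁} {γ₂} {γ₃} {b₁} {b₂} {b₃} {c₁} {c₂} {c₃}
                  (h , h⁻¹ , h∈GL₀ , γ₂≈ , b₂≈ , c₂≈) (k , k⁻¹ , k∈GL₀ , γ₃≈ , b₃≈ , c₃≈) =
    h ⊗ k , k⁻¹ ⊗ h⁻¹ , IsGL₀-⊗ h∈GL₀ k∈GL₀ , γ₃≈′ , b₃≈′ , c₃≈′
    where
    γ₃≈′ : γ₃ ≈M (((k⁻¹ ⊗ h⁻¹) ⊗ γ₁) ⊗ (h ⊗ k))
    γ₃≈′ = begin
      γ₃                                  ≈⟨ γ₃≈ ⟩
      (k⁻¹ ⊗ γ₂) ⊗ k                      ≈⟨ ⊗-congʳ _ (⊗-congˡ _ γ₂≈) ⟩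
      (k⁻¹ ⊗ ((h⁻¹ ⊗ γ₁) ⊗ h)) ⊗ k        ≈⟨ ⊗-congʳ _ (≈M.sym (⊗-assoc k⁻¹ (h⁻¹ ⊗ γ₁) h)) ⟩
      ((k⁻¹ ⊗ (h⁻¹ ⊗ γ₁)) ⊗ h) ⊗ k        ≈⟨ ⊗-assoc (k⁻¹ ⊗ (h⁻¹ ⊗ γ₁)) h k ⟩
      (k⁻¹ ⊗ (h⁻¹ ⊗ γ₁)) ⊗ (h ⊗ k)        ≈⟨ ⊗-congʳ _ (≈M.sym (⊗-assoc k⁻¹ h⁻¹ γ₁)) ⟩
      ((k⁻¹ ⊗ h⁻¹) ⊗ γ₁) ⊗ (h ⊗ k)        ∎
      where open ≈M-Reasoning
    b₃≈′ : b₃ ≈V ((k⁻¹ ⊗ h⁻¹) ▷ b₁)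
    b₃≈′ = ≈V.trans b₃≈ (≈V.trans (▷-cong ≈M.refl b₂≈) (≈V.sym (▷-⊗ k⁻¹ h⁻¹ b₁)))
    c₃≈′ : c₃ ≈V (c₁ ◁ (h ⊗ k))
    c₃≈′ = ≈V.trans c₃≈ (≈V.trans (◁-cong c₂≈ ≈M.refl) (≈V.sym (◁-⊗ c₁ h k)))

  ⊗-comm-pow : ∀ {m} {X Y : Mat m m} → (X ⊗ Y) ≈M (Y ⊗ X) → ∀ k → (X ⊗ pow Y k) ≈M (pow Y k ⊗ X)
  ⊗-comm-pow {X = X} {Y} XY≈YX zero    = ≈M.trans (⊗-identityʳ X) (≈M.sym (⊗-identityˡ X))
  ⊗-comm-pow {X = X} {Y} XY≈YX (suc k) = begin
    X ⊗ (Y ⊗ pow Y k)     ≈⟨ ⊗-Props.uv≈wx⇒u∙vy≈w∙xy XY≈YX (pow Y k) ⟩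
    Y ⊗ (X ⊗ pow Y k)     ≈⟨ ⊗-congˡ _ (⊗-comm-pow XY≈YX k) ⟩
    Y ⊗ (pow Y k ⊗ X)     ≈⟨ ⊗-assoc Y (pow Y k) X ⟨
    (Y ⊗ pow Y k) ⊗ X     ∎
    where open ≈M-Reasoning

  ⊗-comm-inverse : ∀ {m} {X Y Y⁻¹ : Mat m m} → (X ⊗ Y) ≈M (Y ⊗ X) →
                   (Y ⊗ Y⁻¹) ≈M I → (Y⁻¹ ⊗ Y) ≈M I → (X ⊗ Y⁻¹) ≈M (Y⁻¹ ⊗ X)
  ⊗-comm-inverse {X = X} {Y} {Y⁻¹} XY≈YX YY⁻¹≈I Y⁻¹Y≈I = begin
    X ⊗ Y⁻¹                   ≈⟨ ⊗-Props.insertˡ Y⁻¹Y≈I (X ⊗ Y⁻¹) ⟩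
    Y⁻¹ ⊗ (Y ⊗ (X ⊗ Y⁻¹))     ≈⟨ ⊗-congˡ _ (⊗-Props.uv≈wx⇒u∙vy≈w∙xy (≈M.sym XY≈YX) Y⁻¹) ⟩
    Y⁻¹ ⊗ (X ⊗ (Y ⊗ Y⁻¹))     ≈⟨ ⊗-congˡ _ (⊗-Props.elimʳ YY⁻¹≈I X) ⟩
    Y⁻¹ ⊗ X                   ∎
    where open ≈M-Reasoning

  ⊗-comm-⊗ : ∀ {m} {X Y Z : Mat m m} → (X ⊗ Y) ≈M (Y ⊗ X) → (X ⊗ Z) ≈M (Z ⊗ X) →
             (X ⊗ (Y ⊗ Z)) ≈M ((Y ⊗ Z) ⊗ X)
  ⊗-comm-⊗ {X = X} {Y} {Z} XY≈YX XZ≈ZX = begin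
    X ⊗ (Y ⊗ Z)     ≈⟨ ⊗-Props.uv≈wx⇒u∙vy≈w∙xy XY≈YX Z ⟩
    Y ⊗ (X ⊗ Z)     ≈⟨ ⊗-congˡ Y XZ≈ZX ⟩
    Y ⊗ (Z ⊗ X)     ≈⟨ ⊗-assoc Y Z X ⟨
    (Y ⊗ Z) ⊗ X     ∎
    where open ≈M-Reasoning

  ⊗-comm-zpow : ∀ {m} {X Y Y⁻¹ : Mat m m} → (X ⊗ Y) ≈M (Y ⊗ X) → (X ⊗ Y⁻¹) ≈M (Y⁻¹ ⊗ X) →
                ∀ i → (X ⊗ zpow Y Y⁻¹ i) ≈M (zpow Y Y⁻¹ i ⊗ X)
  ⊗-comm-zpow XY≈YX XY⁻¹≈Y⁻¹X (⁺ k)    = ⊗-comm-pow XY≈YX k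
  ⊗-comm-zpow XY≈YX XY⁻¹≈Y⁻¹X -[1+ k ] = ⊗-comm-pow XY⁻¹≈Y⁻¹X (suc k)

  zpow-suc : ∀ {m} {γ γ⁻¹ : Mat m m} → (γ ⊗ γ⁻¹) ≈M I →
             ∀ i → zpow γ γ⁻¹ (i +ℤ ⁺ 1) ≈M (γ ⊗ zpow γ γ⁻¹ i)
  zpow-suc {γ = γ} γγ⁻¹≈I (⁺ k)          = ≈M.reflexive (≡.cong (pow γ) (ℕ.+-comm k 1))
  zpow-suc         γγ⁻¹≈I -[1+ zero ]    = ≈M.sym (⊗-Props.cancelˡ γγ⁻¹≈I I)
  zpow-suc {γ⁻¹ = γ⁻¹} γγ⁻¹≈I -[1+ suc k ] = ⊗-Props.insertˡ γγ⁻¹≈I (pow γ⁻¹ (suc k))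

  -- Twisting elements

  module Twisting {m} {γ B B⁻¹ : Mat m m} (tw : IsTwisting γ B B⁻¹) where
    BB⁻¹≈I : (B ⊗ B⁻¹) ≈M I
    BB⁻¹≈I = proj₁ tw
    B⁻¹B≈I : (B⁻¹ ⊗ B) ≈M I
    B⁻¹B≈I = proj₁ (proj₂ tw)
    γ≈BB̄⁻¹ : γ ≈M (B ⊗ conjM B⁻¹)
    γ≈BB̄⁻¹ = proj₁ (proj₂ (proj₂ tw))
    γ≈B̄⁻¹B : γ ≈M (conjM B⁻¹ ⊗ B)
    γ≈B̄⁻¹B = proj₂ (proj₂ (proj₂ tw))

    B̄B̄⁻¹≈I : (conjM B ⊗ conjM B⁻¹) ≈M I
    B̄B̄⁻¹≈I = conjM-inverse BB⁻¹≈I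

    γB̄≈B : (γ ⊗ conjM B) ≈M B
    γB̄≈B = ≈M.trans (⊗-congʳ _ γ≈BB̄⁻¹) (⊗-Props.cancelʳ (conjM-inverse B⁻¹B≈I) B)

    B̄γ≈B : (conjM B ⊗ γ) ≈M B
    B̄γ≈B = ≈M.trans (⊗-congˡ _ γ≈B̄⁻¹B) (⊗-Props.cancelˡ B̄B̄⁻¹≈I B)

    B⁻¹γ≈B̄⁻¹ : (B⁻¹ ⊗ γ) ≈M conjM B⁻¹
    B⁻¹γ≈B̄⁻¹ = ≈M.trans (⊗-congˡ _ γ≈BB̄⁻¹) (⊗-Props.cancelˡ B⁻¹B≈I (conjM B⁻¹))

    Bγ≈γB : (B ⊗ γ) ≈M (γ ⊗ B)
    Bγ≈γB = begin
      B ⊗ γ                    ≈⟨ ⊗-congˡ _ γ≈B̄⁻¹B ⟩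
      B ⊗ (conjM B⁻¹ ⊗ B)      ≈⟨ ⊗-assoc B (conjM B⁻¹) B ⟨
      (B ⊗ conjM B⁻¹) ⊗ B      ≈⟨ ⊗-congʳ _ γ≈BB̄⁻¹ ⟨
      γ ⊗ B                    ∎
      where open ≈M-Reasoning

  module _ {m} {γ B B⁻¹ : Mat m m} (tw : IsTwisting γ B B⁻¹) where
    open Twisting tw

    B⁻¹▷b-F₀ : ∀ {b : Vect m} → (γ ▷ conjV b) ≈V b → IsF₀V (B⁻¹ ▷ b)
    B⁻¹▷b-F₀ {b} γb̄≈b = begin
      conjV (B⁻¹ ▷ b)            ≈⟨ conjV-▷ B⁻¹ b ⟩
      conjM B⁻¹ ▷ conjV b        ≈⟨ ▷-cong B⁻¹γ≈B̄⁻¹ ≈V.refl ⟨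
      (B⁻¹ ⊗ γ) ▷ conjV b        ≈⟨ ▷-⊗ B⁻¹ γ (conjV b) ⟩
      B⁻¹ ▷ (γ ▷ conjV b)        ≈⟨ ▷-cong ≈M.refl γb̄≈b ⟩
      B⁻¹ ▷ b                    ∎
      where open ≈V-Reasoning

    c◁B̄-F₀ : ∀ {c : Vect m} → (conjV c ◁ γ) ≈V c → IsF₀V (c ◁ conjM B)
    c◁B̄-F₀ {c} c̄γ≈c = begin
      conjV (c ◁ conjM B)            ≈⟨ conjV-◁ c (conjM B) ⟩
      conjV c ◁ conjM (conjM B)      ≈⟨ ◁-cong ≈V.refl (conjM-involutive B) ⟩
      conjV c ◁ B                    ≈⟨ ◁-cong ≈V.refl γB̄≈B ⟨
      conjV c ◁ (γ ⊗ conjM B)        ≈⟨ ◁-⊗ (conjV c) γ (conjM B) ⟩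
      (conjV c ◁ γ) ◁ conjM B        ≈⟨ ◁-cong c̄γ≈c ≈M.refl ⟩
      c ◁ conjM B                    ∎
      where open ≈V-Reasoning

    module _ {γ⁻¹ : Mat m m} (γγ⁻¹≈I : (γ ⊗ γ⁻¹) ≈M I) (γ⁻¹γ≈I : (γ⁻¹ ⊗ γ) ≈M I) where
      B̄γⁱ⁺¹B⁻¹≈γⁱ : ∀ i → ((conjM B ⊗ zpow γ γ⁻¹ (i +ℤ ⁺ 1)) ⊗ B⁻¹) ≈M zpow γ γ⁻¹ i
      B̄γⁱ⁺¹B⁻¹≈γⁱ i = begin
        (conjM B ⊗ zpow γ γ⁻¹ (i +ℤ ⁺ 1)) ⊗ B⁻¹   ≈⟨ ⊗-congʳ B⁻¹ (⊗-congˡ (conjM B) (zpow-suc γγ⁻¹≈I i)) ⟩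
        (conjM B ⊗ (γ ⊗ γⁱ)) ⊗ B⁻¹                ≈⟨ ⊗-congʳ B⁻¹ (≈M.sym (⊗-assoc (conjM B) γ γⁱ)) ⟩
        ((conjM B ⊗ γ) ⊗ γⁱ) ⊗ B⁻¹                ≈⟨ ⊗-congʳ B⁻¹ (⊗-congʳ γⁱ B̄γ≈B) ⟩
        (B ⊗ γⁱ) ⊗ B⁻¹                            ≈⟨ ⊗-congʳ B⁻¹ B-comm-γⁱ ⟩
        (γⁱ ⊗ B) ⊗ B⁻¹                            ≈⟨ ⊗-Props.cancelʳ BB⁻¹≈I γⁱ ⟩
        γⁱ                                        ∎
        where
        open ≈M-Reasoning
        γⁱ = zpow γ γ⁻¹ i
        B-comm-γⁱ : (B ⊗ γⁱ) ≈M (γⁱ ⊗ B)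
        B-comm-γⁱ = ⊗-comm-zpow Bγ≈γB (⊗-comm-inverse Bγ≈γB γγ⁻¹≈I γ⁻¹γ≈I) i

      twisted-pairing : ∀ (b c : Vect m) i →
        ⟪ c ◁ conjM B , zpow γ γ⁻¹ (i +ℤ ⁺ 1) ▷ (B⁻¹ ▷ b) ⟫ ≈ ⟪ c , zpow γ γ⁻¹ i ▷ b ⟫
      twisted-pairing b c i = trans (⟪◁⟫≈⟪▷⟫ c (conjM B) (γⁱ⁺¹ ▷ (B⁻¹ ▷ b))) (⟪⟫-cong ≈V.refl (begin
        conjM B ▷ (γⁱ⁺¹ ▷ (B⁻¹ ▷ b))    ≈⟨ ▷-cong ≈M.refl (▷-⊗ γⁱ⁺¹ B⁻¹ b) ⟨
        conjM B ▷ ((γⁱ⁺¹ ⊗ B⁻¹) ▷ b)    ≈⟨ ▷-⊗ (conjM B) (γⁱ⁺¹ ⊗ B⁻¹) b ⟨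
        (conjM B ⊗ (γⁱ⁺¹ ⊗ B⁻¹)) ▷ b    ≈⟨ ▷-cong (≈M.sym (⊗-assoc (conjM B) γⁱ⁺¹ B⁻¹)) ≈V.refl ⟩
        ((conjM B ⊗ γⁱ⁺¹) ⊗ B⁻¹) ▷ b    ≈⟨ ▷-cong (B̄γⁱ⁺¹B⁻¹≈γⁱ i) ≈V.refl ⟩
        zpow γ γ⁻¹ i ▷ b                ∎))
        where
        open ≈V-Reasoning
        γⁱ⁺¹ = zpow γ γ⁻¹ (i +ℤ ⁺ 1)

  B⁻¹B′-F₀ : ∀ {m} {γ B B⁻¹ B′ B′⁻¹ : Mat m m} →
             IsTwisting γ B B⁻¹ → IsTwisting γ B′ B′⁻¹ → IsF₀M (B⁻¹ ⊗ B′)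
  B⁻¹B′-F₀ {γ = γ} {B} {B⁻¹} {B′} tw tw′ = begin
    conjM (B⁻¹ ⊗ B′)            ≈⟨ conjM-⊗ B⁻¹ B′ ⟩
    conjM B⁻¹ ⊗ conjM B′        ≈⟨ ⊗-congʳ (conjM B′) (Twisting.B⁻¹γ≈B̄⁻¹ tw) ⟨
    (B⁻¹ ⊗ γ) ⊗ conjM B′        ≈⟨ ⊗-assoc B⁻¹ γ (conjM B′) ⟩
    B⁻¹ ⊗ (γ ⊗ conjM B′)        ≈⟨ ⊗-congˡ B⁻¹ (Twisting.γB̄≈B tw′) ⟩
    B⁻¹ ⊗ B′                    ∎
    where open ≈M-Reasoning

  SameOrbit-change-twisting : ∀ {m} {γ B B⁻¹ B′ B′⁻¹ : Mat m m} →
    IsTwisting γ B B⁻¹ → IsTwisting γ B′ B′⁻¹ → ∀ (b c : Vect m) →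
    SameOrbit (γ , B⁻¹ ▷ b , c ◁ conjM B) (γ , B′⁻¹ ▷ b , c ◁ conjM B′)
  SameOrbit-change-twisting {γ = γ} {B} {B⁻¹} {B′} {B′⁻¹} tw tw′ b c =
    H , H⁻¹ , (B⁻¹B′-F₀ tw tw′ , B⁻¹B′-F₀ tw′ tw , HH⁻¹≈I , H⁻¹H≈I) , γ≈H⁻¹γH , b≈ , c≈
    where
    module T = Twisting tw
    module T′ = Twisting tw′
    H H⁻¹ : Mat _ _
    H = B⁻¹ ⊗ B′
    H⁻¹ = B′⁻¹ ⊗ B
    HH⁻¹≈I : (H ⊗ H⁻¹) ≈M I
    HH⁻¹≈I = ≈M.trans (⊗-Props.cancelᶜ T′.BB⁻¹≈I B⁻¹ B) T.B⁻¹B≈I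
    H⁻¹H≈I : (H⁻¹ ⊗ H) ≈M I
    H⁻¹H≈I = ≈M.trans (⊗-Props.cancelᶜ T.BB⁻¹≈I B′⁻¹ B′) T′.B⁻¹B≈I
    γH≈Hγ : (γ ⊗ H) ≈M (H ⊗ γ)
    γH≈Hγ = ⊗-comm-⊗ (⊗-comm-inverse (≈M.sym T.Bγ≈γB) T.BB⁻¹≈I T.B⁻¹B≈I) (≈M.sym T′.Bγ≈γB)
    γ≈H⁻¹γH : γ ≈M ((H⁻¹ ⊗ γ) ⊗ H)
    γ≈H⁻¹γH = ≈M.sym (≈M.trans (⊗-assoc H⁻¹ γ H)
                       (≈M.trans (⊗-congˡ H⁻¹ γH≈Hγ) (⊗-Props.cancelˡ H⁻¹H≈I γ)))
    b≈ : (B′⁻¹ ▷ b) ≈V (H⁻¹ ▷ (B⁻¹ ▷ b))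
    b≈ = ≈V.trans (▷-cong (≈M.sym (⊗-Props.cancelʳ T.BB⁻¹≈I B′⁻¹)) ≈V.refl) (▷-⊗ H⁻¹ B⁻¹ b)
    c≈ : (c ◁ conjM B′) ≈V ((c ◁ conjM B) ◁ H)
    c≈ = begin
      c ◁ conjM B′                                ≈⟨ ◁-cong ≈V.refl (⊗-Props.cancelˡ T.B̄B̄⁻¹≈I (conjM B′)) ⟨
      c ◁ (conjM B ⊗ (conjM B⁻¹ ⊗ conjM B′))      ≈⟨ ◁-cong ≈V.refl (⊗-congˡ (conjM B) (conjM-⊗ B⁻¹ B′)) ⟨
      c ◁ (conjM B ⊗ conjM H)                     ≈⟨ ◁-cong ≈V.refl (⊗-congˡ (conjM B) (B⁻¹B′-F₀ tw tw′)) ⟩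
      c ◁ (conjM B ⊗ H)                           ≈⟨ ◁-⊗ c (conjM B) H ⟩
      (c ◁ conjM B) ◁ H                           ∎
      where open ≈V-Reasoning

  -- Conjugation by GL(V₀♭)(F₀)

  module _ {m} {h h⁻¹ : Mat m m} (h∈GL₀ : IsGL₀ h h⁻¹) where
    private
      h-F₀ : IsF₀M h
      h-F₀ = proj₁ h∈GL₀
      h⁻¹-F₀ : IsF₀M h⁻¹
      h⁻¹-F₀ = proj₁ (proj₂ h∈GL₀)
      hh⁻¹≈I : (h ⊗ h⁻¹) ≈M I
      hh⁻¹≈I = proj₁ (proj₂ (proj₂ h∈GL₀))
      h⁻¹h≈I : (h⁻¹ ⊗ h) ≈M I
      h⁻¹h≈I = proj₂ (proj₂ (proj₂ h∈GL₀))

    conjugate-⊗ : ∀ (X Y : Mat m m) → (((h⁻¹ ⊗ X) ⊗ h) ⊗ ((h⁻¹ ⊗ Y) ⊗ h)) ≈M ((h⁻¹ ⊗ (X ⊗ Y)) ⊗ h)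
    conjugate-⊗ X Y = begin
      ((h⁻¹ ⊗ X) ⊗ h) ⊗ ((h⁻¹ ⊗ Y) ⊗ h)    ≈⟨ ⊗-congˡ ((h⁻¹ ⊗ X) ⊗ h) (⊗-assoc h⁻¹ Y h) ⟩
      ((h⁻¹ ⊗ X) ⊗ h) ⊗ (h⁻¹ ⊗ (Y ⊗ h))    ≈⟨ ⊗-Props.cancelᶜ hh⁻¹≈I (h⁻¹ ⊗ X) (Y ⊗ h) ⟩
      (h⁻¹ ⊗ X) ⊗ (Y ⊗ h)                  ≈⟨ ⊗-Props.uv∙wx≈u[vw∙x] h⁻¹ X Y h ⟩
      h⁻¹ ⊗ ((X ⊗ Y) ⊗ h)                  ≈⟨ ⊗-assoc h⁻¹ (X ⊗ Y) h ⟨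
      (h⁻¹ ⊗ (X ⊗ Y)) ⊗ h                  ∎
      where open ≈M-Reasoning

    conjugate-I : ((h⁻¹ ⊗ I) ⊗ h) ≈M I
    conjugate-I = ≈M.trans (⊗-congʳ h (⊗-identityʳ h⁻¹)) h⁻¹h≈I

    conjM-conjugate : ∀ (X : Mat m m) → conjM ((h⁻¹ ⊗ X) ⊗ h) ≈M ((h⁻¹ ⊗ conjM X) ⊗ h)
    conjM-conjugate X = ≈M.trans (conjM-⊗ (h⁻¹ ⊗ X) h)
                          (⊗-cong (≈M.trans (conjM-⊗ h⁻¹ X) (⊗-congʳ (conjM X) h⁻¹-F₀)) h-F₀)

    conjugate-cong : ∀ {X Y : Mat m m} → X ≈M Y → ((h⁻¹ ⊗ X) ⊗ h) ≈M ((h⁻¹ ⊗ Y) ⊗ h)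
    conjugate-cong X≈Y = ⊗-congʳ h (⊗-congˡ h⁻¹ X≈Y)

    conjugate-inverse : ∀ {X Y : Mat m m} → (X ⊗ Y) ≈M I → (((h⁻¹ ⊗ X) ⊗ h) ⊗ ((h⁻¹ ⊗ Y) ⊗ h)) ≈M I
    conjugate-inverse {X} {Y} XY≈I = ≈M.trans (conjugate-⊗ X Y) (≈M.trans (conjugate-cong XY≈I) conjugate-I)

    IsTwisting-conjugate : ∀ {γ γ₂ B B⁻¹ : Mat m m} → IsTwisting γ B B⁻¹ → γ₂ ≈M ((h⁻¹ ⊗ γ) ⊗ h) →
                           IsTwisting γ₂ ((h⁻¹ ⊗ B) ⊗ h) ((h⁻¹ ⊗ B⁻¹) ⊗ h)
    IsTwisting-conjugate {γ} {γ₂} {B} {B⁻¹} (BB⁻¹≈I , B⁻¹B≈I , γ≈BB̄⁻¹ , γ≈B̄⁻¹B) γ₂≈ =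
      conjugate-inverse BB⁻¹≈I , conjugate-inverse B⁻¹B≈I ,
      ≈M.trans (γ₂≈conjugate γ≈BB̄⁻¹) (⊗-congˡ _ B̄₂⁻¹≈) ,
      ≈M.trans (γ₂≈conjugate γ≈B̄⁻¹B) (⊗-congʳ _ B̄₂⁻¹≈)
      where
      γ₂≈conjugate : ∀ {X Y} → γ ≈M (X ⊗ Y) → γ₂ ≈M (((h⁻¹ ⊗ X) ⊗ h) ⊗ ((h⁻¹ ⊗ Y) ⊗ h))
      γ₂≈conjugate γ≈XY = ≈M.trans γ₂≈ (≈M.trans (conjugate-cong γ≈XY) (≈M.sym (conjugate-⊗ _ _)))
      B̄₂⁻¹≈ : ((h⁻¹ ⊗ conjM B⁻¹) ⊗ h) ≈M conjM ((h⁻¹ ⊗ B⁻¹) ⊗ h)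
      B̄₂⁻¹≈ = ≈M.sym (conjM-conjugate B⁻¹)

    SameOrbit-conjugate : ∀ {γ γ₂ B B⁻¹ : Mat m m} {b b′ c c′ : Vect m} →
      γ₂ ≈M ((h⁻¹ ⊗ γ) ⊗ h) → b′ ≈V (h⁻¹ ▷ b) → c′ ≈V (c ◁ h) →
      SameOrbit (γ , B⁻¹ ▷ b , c ◁ conjM B) (γ₂ , ((h⁻¹ ⊗ B⁻¹) ⊗ h) ▷ b′ , c′ ◁ conjM ((h⁻¹ ⊗ B) ⊗ h))
    SameOrbit-conjugate {γ} {γ₂} {B} {B⁻¹} {b} {b′} {c} {c′} γ₂≈ b′≈ c′≈ =
      h , h⁻¹ , h∈GL₀ , γ₂≈ , b≈ , c≈
      where
      b≈ : (((h⁻¹ ⊗ B⁻¹) ⊗ h) ▷ b′) ≈V (h⁻¹ ▷ (B⁻¹ ▷ b))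
      b≈ = begin
        ((h⁻¹ ⊗ B⁻¹) ⊗ h) ▷ b′              ≈⟨ ▷-cong ≈M.refl b′≈ ⟩
        ((h⁻¹ ⊗ B⁻¹) ⊗ h) ▷ (h⁻¹ ▷ b)       ≈⟨ ▷-⊗ ((h⁻¹ ⊗ B⁻¹) ⊗ h) h⁻¹ b ⟨
        (((h⁻¹ ⊗ B⁻¹) ⊗ h) ⊗ h⁻¹) ▷ b       ≈⟨ ▷-cong (⊗-Props.cancelʳ hh⁻¹≈I (h⁻¹ ⊗ B⁻¹)) ≈V.refl ⟩
        (h⁻¹ ⊗ B⁻¹) ▷ b                     ≈⟨ ▷-⊗ h⁻¹ B⁻¹ b ⟩
        h⁻¹ ▷ (B⁻¹ ▷ b)                     ∎
        where open ≈V-Reasoning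
      c≈ : (c′ ◁ conjM ((h⁻¹ ⊗ B) ⊗ h)) ≈V ((c ◁ conjM B) ◁ h)
      c≈ = begin
        c′ ◁ conjM ((h⁻¹ ⊗ B) ⊗ h)          ≈⟨ ◁-cong c′≈ (conjM-conjugate B) ⟩
        (c ◁ h) ◁ ((h⁻¹ ⊗ conjM B) ⊗ h)     ≈⟨ ◁-⊗ c h ((h⁻¹ ⊗ conjM B) ⊗ h) ⟨
        c ◁ (h ⊗ ((h⁻¹ ⊗ conjM B) ⊗ h))     ≈⟨ ◁-cong ≈V.refl (⊗-Props.uv≈w⇒u[vx∙y]≈w∙xy hh⁻¹≈I _ h) ⟩
        c ◁ (I ⊗ (conjM B ⊗ h))             ≈⟨ ◁-cong ≈V.refl (⊗-identityˡ (conjM B ⊗ h)) ⟩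
        c ◁ (conjM B ⊗ h)                   ≈⟨ ◁-⊗ c (conjM B) h ⟩
        (c ◁ conjM B) ◁ h                   ∎
        where open ≈V-Reasoning

  -- The data attached to γ'

  module _ {m} (G : Gamma' m) where
    open Gamma' G

    private
      ū-inv : (1# - σ d) * σ u ≈ 1#
      ū-inv = trans (*-congʳ (sym (σ-[1-x] d))) (trans (sym (σ-* _ u)) (trans (σ-cong u-inv) σ-1))

      κ : Carrier
      κ = u * (1# - d * σ d) - σ d

      σu*κ≈u : σ u * κ ≈ u
      σu*κ≈u = y[x[1-st]-t]≈x commRing u-inv ū-inv

      γ̄'γ'≈I : (conjM γ' ⊗ γ') ≈M I
      γ̄'γ'≈I = InS-conj {A = γ'} inS

      ⟪c,b̄⟫≈ : ⟪ cr , conjV b ⟫ ≈ 1# - d * σ d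
      ⟪c,b̄⟫≈ = x+y≈z⇒y≈z-x commRing (inS zero zero)
      a▷b̄≈ : ∀ i → (a ▷ conjV b) i ≈ 0# - b i * σ d
      a▷b̄≈ i = x+y≈z⇒y≈z-x commRing (inS (suc i) zero)
      c◁ā≈ : ∀ j → (cr ◁ conjM a) j ≈ 0# - d * σ (cr j)
      c◁ā≈ j = x+y≈z⇒y≈z-x commRing (inS zero (suc j))
      aā≈ : ∀ i j → (a ⊗ conjM a) i j ≈ I i j - b i * σ (cr j)
      aā≈ i j = x+y≈z⇒y≈z-x commRing (inS (suc i) (suc j))
      ⟪c̄,b⟫≈ : ⟪ conjV cr , b ⟫ ≈ 1# - σ d * d
      ⟪c̄,b⟫≈ = x+y≈z⇒y≈z-x commRing (γ̄'γ'≈I zero zero)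
      c̄◁a≈ : ∀ j → (conjV cr ◁ a) j ≈ 0# - σ d * cr j
      c̄◁a≈ j = x+y≈z⇒y≈z-x commRing (γ̄'γ'≈I zero (suc j))

      γ▷b̄≈ : ∀ i → (γ ▷ conjV b) i ≈ b i * κ
      γ▷b̄≈ i = begin
        (γ ▷ conjV b) i                                 ≈⟨ ▷-+rankOne a u b cr (conjV b) i ⟩
        (a ▷ conjV b) i + u * (b i * ⟪ cr , conjV b ⟫)  ≈⟨ +-cong (a▷b̄≈ i) (*-congˡ (*-congˡ ⟪c,b̄⟫≈)) ⟩
        (0# - b i * σ d) + u * (b i * (1# - d * σ d))   ≈⟨ regroup (b i) (σ d) u d ⟩
        b i * κ                                         ∎
        where
        open ≈-Reasoning
        regroup : ∀ b t u d → (0# - b * t) + u * (b * (1# - d * t)) ≈ b * (u * (1# - d * t) - t)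
        regroup = solve 4 (λ b t u d → (:0 :- b :* t) :+ u :* (b :* (:1 :- d :* t))
                                       := b :* (u :* (:1 :- d :* t) :- t)) refl

      c̄◁γ≈ : ∀ j → (conjV cr ◁ γ) j ≈ κ * cr j
      c̄◁γ≈ j = begin
        (conjV cr ◁ γ) j                                ≈⟨ ◁-+rankOne (conjV cr) a u b cr j ⟩
        (conjV cr ◁ a) j + u * (⟪ conjV cr , b ⟫ * cr j) ≈⟨ +-cong (c̄◁a≈ j) (*-congˡ (*-congʳ ⟪c̄,b⟫≈)) ⟩
        (0# - σ d * cr j) + u * ((1# - σ d * d) * cr j) ≈⟨ regroup (cr j) (σ d) u d ⟩
        κ * cr j                                        ∎
        where
        open ≈-Reasoning
        regroup : ∀ c t u d → (0# - t * c) + u * ((1# - t * d) * c) ≈ (u * (1# - d * t) - t) * c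
        regroup = solve 4 (λ c t u d → (:0 :- t :* c) :+ u :* ((:1 :- t :* d) :* c)
                                       := (u :* (:1 :- d :* t) :- t) :* c) refl

    γ∈S : InS γ
    γ∈S i j = begin
      (γ ⊗ conjM γ) i j
        ≈⟨ ⊗-congˡ γ (conjM-+rankOne a u b cr) i j ⟩
      (γ ⊗ (conjM a +M rankOne (σ u) (conjV b) (conjV cr))) i j
        ≈⟨ ⊗-+rankOne γ (conjM a) (σ u) (conjV b) (conjV cr) i j ⟩
      (γ ⊗ conjM a) i j + σ u * ((γ ▷ conjV b) i * σ (cr j))
        ≈⟨ +-cong (+rankOne-⊗ a u b cr (conjM a) i j) (*-congˡ (*-congʳ (γ▷b̄≈ i))) ⟩
      ((a ⊗ conjM a) i j + u * (b i * (cr ◁ conjM a) j)) + σ u * ((b i * κ) * σ (cr j))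
        ≈⟨ +-congʳ (+-cong (aā≈ i j) (*-congˡ (*-congˡ (c◁ā≈ j)))) ⟩
      ((I i j - b i * σ (cr j)) + u * (b i * (0# - d * σ (cr j)))) + σ u * ((b i * κ) * σ (cr j))
        ≈⟨ regroup (I i j) (b i) (σ (cr j)) u (σ u) d κ ⟩
      I i j + (b i * σ (cr j)) * ((σ u * κ - u) + ((1# - d) * u - 1#))
        ≈⟨ +-congˡ (*-congˡ (+-cong (+-congʳ σu*κ≈u) (+-congʳ u-inv))) ⟩
      I i j + (b i * σ (cr j)) * ((u - u) + (1# - 1#))
        ≈⟨ solve 3 (λ x y u → x :+ y :* ((u :- u) :+ (:1 :- :1)) := x) refl (I i j) _ u ⟩
      I i j ∎
      where
      open ≈-Reasoning
      regroup : ∀ e b c u v d k → ((e - b * c) + u * (b * (0# - d * c))) + v * ((b * k) * c)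
                                  ≈ e + (b * c) * ((v * k - u) + ((1# - d) * u - 1#))
      regroup = solve 7 (λ e b c u v d k → ((e :- b :* c) :+ u :* (b :* (:0 :- d :* c))) :+ v :* ((b :* k) :* c)
                                           := e :+ (b :* c) :* ((v :* k :- u) :+ ((:1 :- d) :* u :- :1))) refl

    γ▷β̄₁≈β₁ : (γ ▷ conjV β₁) ≈V β₁
    γ▷β̄₁≈β₁ i = begin
      (γ ▷ conjV β₁) i                    ≈⟨ ▷-cong {A = γ} ≈M.refl (λ l → σ-* u (b l)) i ⟩
      (γ ▷ (λ l → σ u * σ (b l))) i       ≈⟨ ▷-scale (σ u) γ (conjV b) i ⟩
      σ u * (γ ▷ conjV b) i               ≈⟨ *-congˡ (γ▷b̄≈ i) ⟩
      σ u * (b i * κ)                     ≈⟨ solve 3 (λ v b k → v :* (b :* k) := (v :* k) :* b) refl (σ u) (b i) κ ⟩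
      (σ u * κ) * b i                     ≈⟨ *-congʳ σu*κ≈u ⟩
      u * b i                             ∎
      where open ≈-Reasoning

    χ̄₁◁γ≈χ₁ : (conjV χ₁ ◁ γ) ≈V χ₁
    χ̄₁◁γ≈χ₁ j = begin
      (conjV χ₁ ◁ γ) j                    ≈⟨ ◁-cong {A = γ} (λ l → σ-* u (cr l)) ≈M.refl j ⟩
      ((λ l → σ u * σ (cr l)) ◁ γ) j      ≈⟨ ◁-scale (σ u) (conjV cr) γ j ⟩
      σ u * (conjV cr ◁ γ) j              ≈⟨ *-congˡ (c̄◁γ≈ j) ⟩
      σ u * (κ * cr j)                    ≈⟨ *-assoc (σ u) κ (cr j) ⟨
      (σ u * κ) * cr j                    ≈⟨ *-congʳ σu*κ≈u ⟩
      u * cr j                            ∎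
      where open ≈-Reasoning

  ext-⊗-block : ∀ {m} (h a : Mat m m) (b c : Vect m) d →
                (ext h ⊗ block a b c d) ≈M block (h ⊗ a) (h ▷ b) c d
  ext-⊗-block h a b c d zero    zero    = 1#*x+∑0#*≈x d b
  ext-⊗-block h a b c d zero    (suc j) = 1#*x+∑0#*≈x (c j) (λ l → a l j)
  ext-⊗-block h a b c d (suc i) zero    = trans (+-congʳ (zeroˡ d)) (+-identityˡ _)
  ext-⊗-block h a b c d (suc i) (suc j) = trans (+-congʳ (zeroˡ (c j))) (+-identityˡ _)

  block-⊗-ext : ∀ {m} (a : Mat m m) (b c : Vect m) d (h : Mat m m) →
                (block a b c d ⊗ ext h) ≈M block (a ⊗ h) b (c ◁ h) d
  block-⊗-ext a b c d h zero    zero    = x*1#+∑*0#≈x d c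
  block-⊗-ext a b c d h zero    (suc j) = trans (+-congʳ (zeroʳ d)) (+-identityˡ _)
  block-⊗-ext a b c d h (suc i) zero    = x*1#+∑*0#≈x (b i) (a i)
  block-⊗-ext a b c d h (suc i) (suc j) = trans (+-congʳ (zeroʳ (b i))) (+-identityˡ _)

  Conjugate⇒conjugate-data : ∀ {m} (G G′ : Gamma' m) {h h⁻¹ : Mat m m} →
    Gamma'.γ' G′ ≈M ((ext h⁻¹ ⊗ Gamma'.γ' G) ⊗ ext h) →
    Gamma'.γ G′ ≈M ((h⁻¹ ⊗ Gamma'.γ G) ⊗ h) ×
    Gamma'.β₁ G′ ≈V (h⁻¹ ▷ Gamma'.β₁ G) ×
    Gamma'.χ₁ G′ ≈V (Gamma'.χ₁ G ◁ h)
  Conjugate⇒conjugate-data G G′ {h} {h⁻¹} γ'′≈ = γ′≈ , β₁′≈ , χ₁′≈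
    where
    open Gamma' G
    module G′ = Gamma' G′
    blocks≈ : G′.γ' ≈M block ((h⁻¹ ⊗ a) ⊗ h) (h⁻¹ ▷ b) (cr ◁ h) d
    blocks≈ = ≈M.trans γ'′≈ (≈M.trans (⊗-congʳ (ext h) (ext-⊗-block h⁻¹ a b cr d))
                                      (block-⊗-ext (h⁻¹ ⊗ a) (h⁻¹ ▷ b) cr d h))
    u′≈u : G′.u ≈ u
    u′≈u = inverse-unique commRing (trans (*-congʳ (+-congˡ (-‿cong (sym (blocks≈ zero zero))))) G′.u-inv) u-inv
    γ′≈ : G′.γ ≈M ((h⁻¹ ⊗ γ) ⊗ h)
    γ′≈ = begin
      G′.a +M rankOne G′.u G′.b G′.cr
        ≈⟨ +M-cong (λ i j → blocks≈ (suc i) (suc j))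
                   (rankOne-cong u′≈u (λ i → blocks≈ (suc i) zero) (λ j → blocks≈ zero (suc j))) ⟩
      ((h⁻¹ ⊗ a) ⊗ h) +M rankOne u (h⁻¹ ▷ b) (cr ◁ h)
        ≈⟨ +rankOne-⊗ (h⁻¹ ⊗ a) u (h⁻¹ ▷ b) cr h ⟨
      ((h⁻¹ ⊗ a) +M rankOne u (h⁻¹ ▷ b) cr) ⊗ h
        ≈⟨ ⊗-congʳ h (⊗-+rankOne h⁻¹ a u b cr) ⟨
      (h⁻¹ ⊗ γ) ⊗ h ∎
      where open ≈M-Reasoning
    β₁′≈ : G′.β₁ ≈V (h⁻¹ ▷ β₁)
    β₁′≈ i = trans (*-cong u′≈u (blocks≈ (suc i) zero)) (sym (▷-scale u h⁻¹ b i))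
    χ₁′≈ : G′.χ₁ ≈V (χ₁ ◁ h)
    χ₁′≈ j = trans (*-cong u′≈u (blocks≈ zero (suc j))) (sym (◁-scale u cr h j))

proposition3p16 : ∀ {c ℓ : Level} (F : FieldInv c ℓ) (m : ℕ) →
  let open FieldInv F
      open Ops F
  in
  ((G : Gamma' m) → InS (Gamma'.γ G))
  × ((G : Gamma' m) (B Bi : Mat m m) → IsTwisting (Gamma'.γ G) B Bi →
      IsF₀V (b₂ G Bi) × IsF₀V (c₂ G B)
      × ((γi : Mat m m) → (Gamma'.γ G ⊗ γi) ≈M I → (γi ⊗ Gamma'.γ G) ≈M I →
          (i : ℤ) →
          ⟪ c₂ G B , zpow (Gamma'.γ G) γi (i +ℤ ⁺ 1) ▷ b₂ G Bi ⟫
            ≈ ⟪ Gamma'.χ₁ G , zpow (Gamma'.γ G) γi i ▷ Gamma'.β₁ G ⟫))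
  × ((G G' : Gamma' m) (B Bi B' Bi' : Mat m m) →
      IsTwisting (Gamma'.γ G) B Bi → IsTwisting (Gamma'.γ G') B' Bi' →
      Conjugate (Gamma'.γ' G) (Gamma'.γ' G') →
      SameOrbit (Gamma'.γ G , b₂ G Bi , c₂ G B) (Gamma'.γ G' , b₂ G' Bi' , c₂ G' B'))
proposition3p16 F m =
  γ∈S F ,
  (λ G B B⁻¹ tw → B⁻¹▷b-F₀ F tw (γ▷β̄₁≈β₁ F G) , c◁B̄-F₀ F tw (χ̄₁◁γ≈χ₁ F G) ,
     λ γ⁻¹ γγ⁻¹≈I γ⁻¹γ≈I → twisted-pairing F tw γγ⁻¹≈I γ⁻¹γ≈I _ _) ,
  λ { G G′ B B⁻¹ B′ B′⁻¹ tw tw′ (h , h⁻¹ , h∈GL₀ , γ'′≈) →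
      let γ′≈ , β₁′≈ , χ₁′≈ = Conjugate⇒conjugate-data F G G′ γ'′≈ in
      SameOrbit-trans F (SameOrbit-conjugate F h∈GL₀ γ′≈ β₁′≈ χ₁′≈)
                        (SameOrbit-change-twisting F (IsTwisting-conjugate F h∈GL₀ tw γ′≈) tw′ _ _) }
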